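{- Consider the following task for a register machine: it reads a positive integer $m$, then $m$ positive integers $q_1,\ldots,q_m$, then an integer $k\in\{1,\ldots,m\}$ (in this order), and must output $q_k$. Let $r=\log(\max\{2,q_1,\ldots,q_m\})$ and $f(m,r)=r\cdot m\cdot\log(m)$. Then (i) no register machine solves this task in $o(f(m,r))$ steps when the Little Oh is taken in sense (a); and (ii) there is a register machine solving this task in $o(f(m,r))$ steps when the Little Oh is taken in sense (b).
   Context: Model (addition machine): a program is a finite list of numbered lines; the machine has finitely many registers, each holding an arbitrary integer. Allowed commands, each counting as one step: $x=y+z$, $x=y+k$, $x=y-z$, $x=y-k$, $x=k-y$, $x=k$ (registers $x,y,z$, integer constants $k$); "read $x$"/"write $x$" of a whole integer; "if $x\,R\,y$" and "if $x\,R\,k$" conditionals with $R\in\{<,=,>,\neq,\leq,\geq\}$; "goto $\ell$". Finitely many finite-range variables may also be used. The running time on an input is the number of executed commands; a machine solves the task in $o(f(m,r))$ steps if its (worst-case) running time $g(m,r)$ over inputs with parameters $m,r$ satisfies $g\in o(f)$. Multivariate Little Oh: (a) $g(m,r)\in o(f(m,r))$ iff for every rational $c>0$ there is $c'>0$ such that for all $(m,r)$ with $\max\{m,r\}\geq c'$ one has $g(m,r)\leq c\cdot f(m,r)$; (b) $g(m,r)\in o(f(m,r))$ iff for every rational $c>0$ there is $c'$ such that for all $(m,r)$ with $\min\{m,r\}\geq c'$ one has $g(m,r)\leq c\cdot f(m,r)$. -}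

module Defs where

open import Data.Nat as ℕ using (ℕ; zero; suc; _⊔_; _≤_; _*_)
open import Data.Nat.Logarithm using (⌊log₂_⌋)
open import Data.Integer as ℤ using (ℤ; +_)
open import Data.Fin using (Fin; toℕ)
open import Data.List using (List; []; _∷_; _++_; [_]; map; length; lookup)
open import Data.Vec using (Vec; toList; foldr)
import Data.Vec as Vec
open import Data.Vec.Relation.Unary.All using (All)
open import Data.Maybe using (Maybe; just; nothing)
open import Data.Product using (_×_; Σ; ∃; _,_)
open import Data.Sum using (_⊎_)
open import Data.Bool using (Bool; true; false; if_then_else_)
open import Relation.Nullary.Decidable using (⌊_⌋)
open import Relation.Binary.PropositionalEquality using (_≡_)

data Rel : Set where
  lt eq gt neq le ge : Rel

evalRel : Rel → ℤ → ℤ → Bool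
evalRel lt  a b = ⌊ a ℤ.<? b ⌋
evalRel eq  a b = ⌊ a ℤ.≟ b ⌋
evalRel gt  a b = ⌊ b ℤ.<? a ⌋
evalRel neq a b = Data.Bool.not ⌊ a ℤ.≟ b ⌋
evalRel le  a b = ⌊ a ℤ.≤? b ⌋
evalRel ge  a b = ⌊ b ℤ.≤? a ⌋

data Instr (n : ℕ) : Set where
  addR  : Fin n → Fin n → Fin n → Instr n
  addK  : Fin n → Fin n → ℤ → Instr n
  subR  : Fin n → Fin n → Fin n → Instr n
  subK  : Fin n → Fin n → ℤ → Instr n
  rsubK : Fin n → ℤ → Fin n → Instr n
  const : Fin n → ℤ → Instr n
  read  : Fin n → Instr n
  write : Fin n → Instr n
  ifR   : Fin n → Rel → Fin n → Instr n
  ifK   : Fin n → Rel → ℤ → Instr n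
  goto  : ℕ → Instr n

-- A program: lines numbered 0,1,2,...; execution starts at line 0 and
-- stops when the program counter leaves the program.
Program : ℕ → Set
Program n = List (Instr n)

record Config (n : ℕ) : Set where
  constructor cfg
  field
    pc    : ℕ
    regs  : Fin n → ℤ
    input : List ℤ
    out   : List ℤ

open Config public

update : ∀ {n} → (Fin n → ℤ) → Fin n → ℤ → (Fin n → ℤ)
update {n} ρ x v y = if ⌊ x Data.Fin.≟ y ⌋ then v else ρ y

lineAt : ∀ {n} → Program n → ℕ → Maybe (Instr n)
lineAt [] _ = nothing
lineAt (i ∷ p) zero = just i
lineAt (i ∷ p) (suc l) = lineAt p l

-- Effect of executing one command in a given configuration.
-- "if cond": if cond holds, continue with the next line, otherwise skip it.
-- "read x" on exhausted input stops the machine (result nothing).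
exec : ∀ {n} → Instr n → Config n → Maybe (Config n)
exec (addR x y z)  (cfg l ρ i o) = just (cfg (suc l) (update ρ x (ρ y ℤ.+ ρ z)) i o)
exec (addK x y k)  (cfg l ρ i o) = just (cfg (suc l) (update ρ x (ρ y ℤ.+ k)) i o)
exec (subR x y z)  (cfg l ρ i o) = just (cfg (suc l) (update ρ x (ρ y ℤ.- ρ z)) i o)
exec (subK x y k)  (cfg l ρ i o) = just (cfg (suc l) (update ρ x (ρ y ℤ.- k)) i o)
exec (rsubK x k y) (cfg l ρ i o) = just (cfg (suc l) (update ρ x (k ℤ.- ρ y)) i o)
exec (const x k)   (cfg l ρ i o) = just (cfg (suc l) (update ρ x k) i o)
exec (read x)      (cfg l ρ [] o) = nothing
exec (read x)      (cfg l ρ (v ∷ i) o) = just (cfg (suc l) (update ρ x v) i o)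
exec (write x)     (cfg l ρ i o) = just (cfg (suc l) ρ i (o ++ [ ρ x ]))
exec (ifR x R y)   (cfg l ρ i o) =
  just (cfg (if evalRel R (ρ x) (ρ y) then suc l else suc (suc l)) ρ i o)
exec (ifK x R k)   (cfg l ρ i o) =
  just (cfg (if evalRel R (ρ x) k then suc l else suc (suc l)) ρ i o)
exec (goto ℓ)      (cfg l ρ i o) = just (cfg ℓ ρ i o)

step : ∀ {n} → Program n → Config n → Maybe (Config n)
step P c with lineAt P (pc c)
... | nothing = nothing
... | just ins = exec ins c

data Runs {n : ℕ} (P : Program n) : Config n → ℕ → List ℤ → Set where
  stop : ∀ {c} → step P c ≡ nothing → Runs P c 0 (out c)
  go   : ∀ {c c' t o} → step P c ≡ just c' → Runs P c' t o → Runs P c (suc t) o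

initial : ∀ {n} → List ℤ → Config n
initial inp = cfg 0 (λ _ → + 0) inp []

HaltsWith : ∀ {n} → Program n → List ℤ → ℕ → List ℤ → Set
HaltsWith P inp t o = Runs P (initial inp) t o

-- input stream: m, q_1, ..., q_m, k   (k ∈ {1,...,m} given as Fin m)
taskInput : (m : ℕ) → Vec ℕ m → Fin m → List ℤ
taskInput m qs k = (+ m) ∷ map +_ (toList qs) ++ [ + suc (toℕ k) ]

Valid : (m : ℕ) → Vec ℕ m → Set
Valid m qs = (1 ≤ m) × All (1 ≤_) qs

maxQ : ∀ {m} → Vec ℕ m → ℕ
maxQ qs = foldr _ _⊔_ 2 qs

rOf : ∀ {m} → Vec ℕ m → ℕ
rOf qs = ⌊log₂ maxQ qs ⌋

f : ℕ → ℕ → ℕ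
f m r = r * m * ⌊log₂ m ⌋

Solves : ∀ {n} → Program n → Set
Solves P = ∀ m (qs : Vec ℕ m) (k : Fin m) → Valid m qs →
  ∃ λ t → HaltsWith P (taskInput m qs k) t [ + Vec.lookup qs k ]

-- Running time in o(f(m,r)), Little Oh in sense (a).
-- A rational c > 0 is written (suc a)/(suc b); thresholds c' are naturals
-- (WLOG, round c' up).  "max{m,r} ≥ c'" is  c' ≤ m ⊎ c' ≤ r.
LittleOhA : ∀ {n} → Program n → Set
LittleOhA P = ∀ (a b : ℕ) → ∃ λ (c' : ℕ) →
  ∀ m (qs : Vec ℕ m) (k : Fin m) → Valid m qs →
  (c' ≤ m ⊎ c' ≤ rOf qs) →
  ∀ t o → HaltsWith P (taskInput m qs k) t o →
  suc b * t ≤ suc a * f m (rOf qs)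

-- Little Oh in sense (b): "min{m,r} ≥ c'" is  c' ≤ m × c' ≤ r.
LittleOhB : ∀ {n} → Program n → Set
LittleOhB P = ∀ (a b : ℕ) → ∃ λ (c' : ℕ) →
  ∀ m (qs : Vec ℕ m) (k : Fin m) → Valid m qs →
  (c' ≤ m × c' ≤ rOf qs) →
  ∀ t o → HaltsWith P (taskInput m qs k) t o →
  suc b * t ≤ suc a * f m (rOf qs)

{-# OPTIONS --safe #-}
-- (i) In sense (a) the threshold may be met by r alone, so inputs with m = 1
-- are admissible; for them f(1, r) = r · 1 · ⌊log₂ 1⌋ = 0, while producing
-- any output takes at least one step.
--
-- (ii) The machine reads q₁ … q_m into three integers: Z, the concatenation
-- of the binary expansions of the qᵢ; Y, of the same length, with a 1 exactly
-- at the leading digit of each expansion; and T = 2^|Z|.  Finding the bit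
-- length of qᵢ by doubling costs O(r) steps per input.  After reading k it
-- peels off the digits of Z and Y from the top (double, compare with T,
-- subtract), counting the marks of Y down from k and accumulating the digits
-- of Z inside the k-th block; this costs O(|Z|) = O(m r) steps.  Since
-- m r ≤ r m ⌊log₂ m⌋ / c as soon as ⌊log₂ m⌋ ≥ c, the running time is in
-- o(f) when min{m, r} is large.
module Submission where

open import Defs
open import Data.Nat using (ℕ; zero; suc; _+_; _*_; _∸_; _≤_; _<_; _^_; _⊔_; z≤n; s≤s)
open import Data.Nat.Properties
open import Data.Nat.Logarithm using (⌊log₂_⌋; ⌊log₂⌋-mono-≤; ⌊log₂[2^n]⌋≡n)
open import Data.Integer as ℤ using (ℤ; +_; -[1+_])
import Data.Integer.Properties as ℤ
open import Data.Fin as Fin using (Fin; toℕ)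
open import Data.List as List using (List; []; _∷_; _++_; [_]; length; replicate)
open import Data.List.Properties using (length-++; ++-assoc; ++-identityʳ; length-replicate)
open import Data.Vec as Vec using (Vec; lookup; toList; _[_]≔_)
open import Data.Vec.Properties using (lookup∘update; lookup∘update′; lookup-replicate)
open import Data.Vec.Relation.Unary.All as All using (All)
open import Data.Maybe using (Maybe; just; nothing)
open import Data.Product using (_×_; Σ; ∃; _,_; proj₁; proj₂)
open import Data.Sum using (inj₂)
open import Data.Bool using (Bool; true; false; if_then_else_)
open import Relation.Nullary using (yes; no; ¬_; contradiction)
open import Relation.Nullary.Decidable using (dec-true; dec-false; isYes≗does)
open import Relation.Binary.PropositionalEquality hiding ([_])
open import Data.Nat.Solver using (module +-*-Solver)
open +-*-Solver

-- Registers stored in a vector rather than a function, so that concrete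
-- register files can be compared with ≡ (no function extensionality needed).
record VConfig (n : ℕ) : Set where
  constructor vcfg
  field
    vpc    : ℕ
    vregs  : Vec ℤ n
    vinput : List ℤ
    vout   : List ℤ

open VConfig

execV : ∀ {n} → Instr n → VConfig n → Maybe (VConfig n)
execV (addR x y z)  (vcfg l ρ i o) = just (vcfg (suc l) (ρ [ x ]≔ (lookup ρ y ℤ.+ lookup ρ z)) i o)
execV (addK x y k)  (vcfg l ρ i o) = just (vcfg (suc l) (ρ [ x ]≔ (lookup ρ y ℤ.+ k)) i o)
execV (subR x y z)  (vcfg l ρ i o) = just (vcfg (suc l) (ρ [ x ]≔ (lookup ρ y ℤ.- lookup ρ z)) i o)
execV (subK x y k)  (vcfg l ρ i o) = just (vcfg (suc l) (ρ [ x ]≔ (lookup ρ y ℤ.- k)) i o)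
execV (rsubK x k y) (vcfg l ρ i o) = just (vcfg (suc l) (ρ [ x ]≔ (k ℤ.- lookup ρ y)) i o)
execV (const x k)   (vcfg l ρ i o) = just (vcfg (suc l) (ρ [ x ]≔ k) i o)
execV (read x)      (vcfg l ρ [] o) = nothing
execV (read x)      (vcfg l ρ (v ∷ i) o) = just (vcfg (suc l) (ρ [ x ]≔ v) i o)
execV (write x)     (vcfg l ρ i o) = just (vcfg (suc l) ρ i (o ++ [ lookup ρ x ]))
execV (ifR x R y)   (vcfg l ρ i o) =
  just (vcfg (if evalRel R (lookup ρ x) (lookup ρ y) then suc l else suc (suc l)) ρ i o)
execV (ifK x R k)   (vcfg l ρ i o) =
  just (vcfg (if evalRel R (lookup ρ x) k then suc l else suc (suc l)) ρ i o)
execV (goto ℓ)      (vcfg l ρ i o) = just (vcfg ℓ ρ i o)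

stepV : ∀ {n} → Program n → VConfig n → Maybe (VConfig n)
stepV P s with lineAt P (vpc s)
... | nothing = nothing
... | just ins = execV ins s

data RunsV {n : ℕ} (P : Program n) : VConfig n → ℕ → List ℤ → Set where
  vstop : ∀ {s} → stepV P s ≡ nothing → RunsV P s 0 (vout s)
  vgo   : ∀ {s s' t o} → stepV P s ≡ just s' → RunsV P s' t o → RunsV P s (suc t) o

infixr 5 _▹_

data ReachesV {n : ℕ} (P : Program n) : VConfig n → ℕ → VConfig n → Set where
  done : ∀ {s} → ReachesV P s 0 s
  _▹_  : ∀ {s s' t s''} → stepV P s ≡ just s' → ReachesV P s' t s'' → ReachesV P s (suc t) s''

reaches-runs : ∀ {n} {P : Program n} {s s' t t' o} →
  ReachesV P s t s' → RunsV P s' t' o → RunsV P s (t + t') o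
reaches-runs done    r' = r'
reaches-runs (e ▹ r) r' = vgo e (reaches-runs r r')

update-≗ : ∀ {n} (ρ : Fin n → ℤ) vs x v → ρ ≗ lookup vs → update ρ x v ≗ lookup (vs [ x ]≔ v)
update-≗ ρ vs x v ρ≗vs y with x Fin.≟ y
... | yes refl = sym (lookup∘update x vs v)
... | no x≢y   = trans (ρ≗vs y) (sym (lookup∘update′ (λ y≡x → x≢y (sym y≡x)) vs v))

StepSimulates : ∀ {n} → (Config n → Maybe (Config n)) → (VConfig n → Maybe (VConfig n)) → Set
StepSimulates st stV = ∀ l ρ vs i o → ρ ≗ lookup vs →
  (∀ s' → stV (vcfg l vs i o) ≡ just s' →
     ∃ λ ρ' → st (cfg l ρ i o) ≡ just (cfg (vpc s') ρ' (vinput s') (vout s')) × ρ' ≗ lookup (vregs s'))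
  × (stV (vcfg l vs i o) ≡ nothing → st (cfg l ρ i o) ≡ nothing)

assigned : ∀ {n l i o} {ρ : Fin n → ℤ} vs x {a a'} → a ≡ a' → ρ ≗ lookup vs →
  ∃ λ ρ' → just (cfg (suc l) (update ρ x a) i o) ≡ just (cfg (suc l) ρ' i o) × ρ' ≗ lookup (vs [ x ]≔ a')
assigned vs x refl ρ≗ = _ , refl , update-≗ _ vs x _ ρ≗

exec-simulates : ∀ {n} (ins : Instr n) → StepSimulates (exec ins) (execV ins)
exec-simulates (addR x y z)  l ρ vs i o ρ≗ = (λ { _ refl → assigned vs x (cong₂ ℤ._+_ (ρ≗ y) (ρ≗ z)) ρ≗ }) , λ ()
exec-simulates (addK x y k)  l ρ vs i o ρ≗ = (λ { _ refl → assigned vs x (cong (ℤ._+ k) (ρ≗ y)) ρ≗ }) , λ ()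
exec-simulates (subR x y z)  l ρ vs i o ρ≗ = (λ { _ refl → assigned vs x (cong₂ ℤ._-_ (ρ≗ y) (ρ≗ z)) ρ≗ }) , λ ()
exec-simulates (subK x y k)  l ρ vs i o ρ≗ = (λ { _ refl → assigned vs x (cong (ℤ._- k) (ρ≗ y)) ρ≗ }) , λ ()
exec-simulates (rsubK x k y) l ρ vs i o ρ≗ = (λ { _ refl → assigned vs x (cong (λ a → k ℤ.- a) (ρ≗ y)) ρ≗ }) , λ ()
exec-simulates (const x k)   l ρ vs i o ρ≗ = (λ { _ refl → assigned vs x refl ρ≗ }) , λ ()
exec-simulates (read x)      l ρ vs [] o ρ≗ = (λ _ ()) , λ _ → refl
exec-simulates (read x)      l ρ vs (v ∷ i) o ρ≗ = (λ { _ refl → assigned vs x refl ρ≗ }) , λ ()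
exec-simulates (write x)     l ρ vs i o ρ≗ =
  (λ { _ refl → _ , cong (λ a → just (cfg (suc l) ρ i (o ++ [ a ]))) (ρ≗ x) , ρ≗ }) , λ ()
exec-simulates (ifR x R y)   l ρ vs i o ρ≗ =
  (λ { _ refl → _ , cong₂ (λ a b → just (cfg (if evalRel R a b then suc l else suc (suc l)) ρ i o)) (ρ≗ x) (ρ≗ y)
                  , ρ≗ }) , λ ()
exec-simulates (ifK x R k)   l ρ vs i o ρ≗ =
  (λ { _ refl → _ , cong (λ a → just (cfg (if evalRel R a k then suc l else suc (suc l)) ρ i o)) (ρ≗ x) , ρ≗ }) , λ ()
exec-simulates (goto ℓ)      l ρ vs i o ρ≗ = (λ { _ refl → _ , refl , ρ≗ }) , λ ()

step-simulates : ∀ {n} (P : Program n) → StepSimulates (step P) (stepV P)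
step-simulates P l ρ vs i o ρ≗ with lineAt P l
... | nothing  = (λ _ ()) , λ _ → refl
... | just ins = exec-simulates ins l ρ vs i o ρ≗

runsV⇒runs : ∀ {n} (P : Program n) {t res} l ρ vs i o → ρ ≗ lookup vs →
  RunsV P (vcfg l vs i o) t res → Runs P (cfg l ρ i o) t res
runsV⇒runs P l ρ vs i o ρ≗ (vstop e) = stop (proj₂ (step-simulates P l ρ vs i o ρ≗) e)
runsV⇒runs P l ρ vs i o ρ≗ (vgo {s' = vcfg l' vs' i' o'} e r)
  with proj₁ (step-simulates P l ρ vs i o ρ≗) _ e
... | ρ' , e' , ρ'≗ = go e' (runsV⇒runs P l' ρ' vs' i' o' ρ'≗ r)

runs-time-unique : ∀ {n} {P : Program n} {c t t' o o'} → Runs P c t o → Runs P c t' o' → t ≡ t'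
runs-time-unique (stop e) (stop e') = refl
runs-time-unique (stop e) (go e' r') with trans (sym e) e'
... | ()
runs-time-unique (go e r) (stop e') with trans (sym e) e'
... | ()
runs-time-unique (go e r) (go e' r') with trans (sym e) e'
... | refl = cong suc (runs-time-unique r r')

-- x · 2ⁿ, computed by doubling as the machine does it (x = x + x).
infix 8 _≪_

_≪_ : ℕ → ℕ → ℕ
x ≪ zero  = x
x ≪ suc n = (x ≪ n) + (x ≪ n)

≪-distribʳ-+ : ∀ x y n → (x + y) ≪ n ≡ (x ≪ n) + (y ≪ n)
≪-distribʳ-+ x y zero = refl
≪-distribʳ-+ x y (suc n) rewrite ≪-distribʳ-+ x y n =
  solve 2 (λ a b → (a :+ b) :+ (a :+ b) := (a :+ a) :+ (b :+ b)) refl (x ≪ n) (y ≪ n)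

≪-≪ : ∀ x m n → (x ≪ m) ≪ n ≡ x ≪ (n + m)
≪-≪ x m zero = refl
≪-≪ x m (suc n) rewrite ≪-≪ x m n = refl

0≪n≡0 : ∀ n → 0 ≪ n ≡ 0
0≪n≡0 zero = refl
0≪n≡0 (suc n) rewrite 0≪n≡0 n = refl

≪-monoˡ-< : ∀ {x y} n → x < y → x ≪ n < y ≪ n
≪-monoˡ-< zero x<y = x<y
≪-monoˡ-< (suc n) x<y = +-mono-< (≪-monoˡ-< n x<y) (≪-monoˡ-< n x<y)

1≪n≡2^n : ∀ n → 1 ≪ n ≡ 2 ^ n
1≪n≡2^n zero = refl
1≪n≡2^n (suc n) rewrite 1≪n≡2^n n | +-identityʳ (2 ^ n) = refl

1≪m<1≪n⇒m<n : ∀ {m n} → 1 ≪ m < 1 ≪ n → m < n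
1≪m<1≪n⇒m<n {m} {n} 2ᵐ<2ⁿ with m <? n
... | yes m<n = m<n
... | no  m≮n = contradiction 2ᵐ<2ⁿ
  (≤⇒≯ (subst₂ _≤_ (sym (1≪n≡2^n n)) (sym (1≪n≡2^n m)) (^-monoʳ-≤ 2 (≮⇒≥ m≮n))))

bit : Bool → ℕ
bit true  = 1
bit false = 0

bit-≪ : ∀ b n → bit b ≪ n ≡ (if b then 1 ≪ n else 0)
bit-≪ true  n = refl
bit-≪ false n = 0≪n≡0 n

-- Binary numerals, most significant bit first.
fromBits : List Bool → ℕ
fromBits []       = 0
fromBits (b ∷ bs) = (if b then 1 ≪ length bs else 0) + fromBits bs

fromBits< : ∀ bs → fromBits bs < 1 ≪ length bs
fromBits< []           = s≤s z≤n
fromBits< (true ∷ bs)  = +-monoʳ-< (1 ≪ length bs) (fromBits< bs)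
fromBits< (false ∷ bs) = ≤-trans (fromBits< bs) (m≤m+n _ _)

fromBits-++ : ∀ xs ys → fromBits (xs ++ ys) ≡ (fromBits xs ≪ length ys) + fromBits ys
fromBits-++ []           ys rewrite 0≪n≡0 (length ys) = refl
fromBits-++ (false ∷ xs) ys = fromBits-++ xs ys
fromBits-++ (true ∷ xs)  ys
  rewrite fromBits-++ xs ys | ≪-distribʳ-+ (1 ≪ length xs) (fromBits xs) (length ys)
        | ≪-≪ 1 (length xs) (length ys) | length-++ xs {ys} | +-comm (length xs) (length ys) =
  sym (+-assoc (1 ≪ (length ys + length xs)) _ _)

fromBits-replicate-false : ∀ n → fromBits (replicate n false) ≡ 0
fromBits-replicate-false zero    = refl
fromBits-replicate-false (suc n) = fromBits-replicate-false n

fromBits-true∷-≪ : ∀ bs j →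
  (fromBits (true ∷ bs) ≪ suc j) ≡ (1 ≪ (j + suc (length bs))) + (fromBits bs ≪ suc j)
fromBits-true∷-≪ bs j =
  trans (≪-distribʳ-+ (1 ≪ length bs) (fromBits bs) (suc j))
    (cong (_+ (fromBits bs ≪ suc j))
      (trans (≪-≪ 1 (length bs) (suc j)) (cong (1 ≪_) (sym (+-suc j (length bs))))))

fromBits-≪< : ∀ bs j → (fromBits bs ≪ suc j) < 1 ≪ (j + suc (length bs))
fromBits-≪< bs j =
  subst ((fromBits bs ≪ suc j) <_)
    (trans (≪-≪ 1 (length bs) (suc j)) (cong (1 ≪_) (sym (+-suc j (length bs)))))
    (≪-monoˡ-< (suc j) (fromBits< bs))

fixedWidthBits : ∀ n x → x < 1 ≪ n → ∃ λ bs → length bs ≡ n × fromBits bs ≡ x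
fixedWidthBits zero zero _ = [] , refl , refl
fixedWidthBits zero (suc x) (s≤s ())
fixedWidthBits (suc n) x x<2ⁿ⁺¹ with x <? 1 ≪ n
... | yes x<2ⁿ with fixedWidthBits n x x<2ⁿ
...   | bs , refl , v = false ∷ bs , refl , v
fixedWidthBits (suc n) x x<2ⁿ⁺¹ | no x≮2ⁿ
  with fixedWidthBits n (x ∸ (1 ≪ n))
         (+-cancelʳ-< _ _ _ (subst (_< (1 ≪ n) + (1 ≪ n)) (sym (m∸n+n≡m (≮⇒≥ x≮2ⁿ))) x<2ⁿ⁺¹))
... | bs , refl , v = true ∷ bs , refl , trans (cong (λ y → (1 ≪ n) + y) v) (m+[n∸m]≡n (≮⇒≥ x≮2ⁿ))

horner : ℕ → List Bool → ℕ
horner v []       = v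
horner v (b ∷ bs) = horner (v + v + bit b) bs

horner-≡ : ∀ v bs → horner v bs ≡ (v ≪ length bs) + fromBits bs
horner-≡ v [] = sym (+-identityʳ v)
horner-≡ v (b ∷ bs)
  rewrite horner-≡ (v + v + bit b) bs | ≪-distribʳ-+ (v + v) (bit b) (length bs)
        | ≪-distribʳ-+ v v (length bs) | bit-≪ b (length bs) =
  +-assoc ((v ≪ length bs) + (v ≪ length bs)) _ _

horner-bit : ∀ b bs → horner (bit b) bs ≡ fromBits (b ∷ bs)
horner-bit b bs = trans (horner-≡ (bit b) bs) (cong (_+ fromBits bs) (bit-≪ b (length bs)))

2^n≤m⇒n≤⌊log₂m⌋ : ∀ n m → 2 ^ n ≤ m → n ≤ ⌊log₂ m ⌋
2^n≤m⇒n≤⌊log₂m⌋ n m 2ⁿ≤m = subst (_≤ ⌊log₂ m ⌋) (⌊log₂[2^n]⌋≡n n) (⌊log₂⌋-mono-≤ 2ⁿ≤m)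

m<2^[1+⌊log₂m⌋] : ∀ m → m < 2 ^ suc ⌊log₂ m ⌋
m<2^[1+⌊log₂m⌋] m with m <? 2 ^ suc ⌊log₂ m ⌋
... | yes m< = m<
... | no  m≮ = contradiction (2^n≤m⇒n≤⌊log₂m⌋ (suc ⌊log₂ m ⌋) m (≮⇒≥ m≮)) (n≮n _)

≤maxQ : ∀ {m} (qs : Vec ℕ m) → All (_≤ maxQ qs) qs
≤maxQ Vec.[] = All.[]
≤maxQ (q Vec.∷ qs) =
  m≤m⊔n q (maxQ qs) All.∷ All.map (λ q'≤ → ≤-trans q'≤ (m≤n⊔m q (maxQ qs))) (≤maxQ qs)

Fits : ℕ → ℕ → Set
Fits R q = 1 ≤ q × q < 1 ≪ suc R

inputs-fit : ∀ {m} (qs : Vec ℕ m) → All (1 ≤_) qs → All (Fits (rOf qs)) qs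
inputs-fit qs positive = All.map {P = λ q → 1 ≤ q × q ≤ maxQ qs} fits (All.zip (positive , ≤maxQ qs))
  where
  fits : ∀ {q} → 1 ≤ q × q ≤ maxQ qs → Fits (rOf qs) q
  fits {q} (1≤q , q≤M) =
    1≤q , subst (q <_) (sym (1≪n≡2^n (suc (rOf qs)))) (≤-<-trans q≤M (m<2^[1+⌊log₂m⌋] (maxQ qs)))

+[m+n]-+m≡+n : ∀ m n → + (m + n) ℤ.- + m ≡ + n
+[m+n]-+m≡+n m n =
  trans (ℤ.m-n≡m⊖n (m + n) m) (trans (ℤ.⊖-≥ (m≤m+n m n)) (cong +_ (m+n∸m≡n m n)))

lt-true : ∀ {a b} → a < b → evalRel lt (+ a) (+ b) ≡ true
lt-true {a} {b} a<b = trans (isYes≗does (+ a ℤ.<? + b)) (dec-true (+ a ℤ.<? + b) (ℤ.+<+ a<b))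

lt-false : ∀ {a b} → b ≤ a → evalRel lt (+ a) (+ b) ≡ false
lt-false {a} {b} b≤a =
  trans (isYes≗does (+ a ℤ.<? + b)) (dec-false (+ a ℤ.<? + b) (λ { (ℤ.+<+ a<b) → <⇒≱ a<b b≤a }))

rK rV rP rZ rY rT : Fin 6
rK = Fin.zero
rV = Fin.suc Fin.zero
rP = Fin.suc (Fin.suc Fin.zero)
rZ = Fin.suc (Fin.suc (Fin.suc Fin.zero))
rY = Fin.suc (Fin.suc (Fin.suc (Fin.suc Fin.zero)))
rT = Fin.suc (Fin.suc (Fin.suc (Fin.suc (Fin.suc Fin.zero))))

-- rK counts the inputs still to be read and later holds k; rV holds the
-- current input and later the output; rP is the power of two compared with
-- the input and later the bit just taken off Z.  Jump targets are numbered.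
selector : Program 6
selector =
  read rK ∷
  const rT (+ 1) ∷
  ifK rK le (+ 0) ∷         -- 2
  goto 20 ∷
  read rV ∷
  const rP (+ 1) ∷
  addR rZ rZ rZ ∷
  addR rY rY rY ∷
  addK rY rY (+ 1) ∷
  addR rT rT rT ∷
  addR rP rP rP ∷           -- 10
  ifR rP gt rV ∷
  goto 17 ∷
  addR rZ rZ rZ ∷
  addR rY rY rY ∷
  addR rT rT rT ∷
  goto 10 ∷
  addR rZ rZ rV ∷           -- 17
  subK rK rK (+ 1) ∷
  goto 2 ∷
  addR rZ rZ rZ ∷           -- 20
  addR rY rY rY ∷
  addK rY rY (+ 1) ∷
  addR rT rT rT ∷
  read rK ∷
  const rV (+ 0) ∷
  addR rZ rZ rZ ∷           -- 26
  addR rY rY rY ∷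
  const rP (+ 0) ∷
  ifR rZ lt rT ∷
  goto 33 ∷
  subR rZ rZ rT ∷
  const rP (+ 1) ∷
  ifR rY lt rT ∷            -- 33
  goto 37 ∷
  subR rY rY rT ∷
  subK rK rK (+ 1) ∷
  ifK rK neq (+ 0) ∷        -- 37
  goto 41 ∷
  addR rV rV rV ∷
  addR rV rV rP ∷
  ifK rK ge (+ 0) ∷         -- 41
  goto 26 ∷
  write rV ∷
  []

state : ℕ → (k v p z y t : ℤ) → List ℤ → List ℤ → VConfig 6
state l k v p z y t i o = vcfg l (k Vec.∷ v Vec.∷ p Vec.∷ z Vec.∷ y Vec.∷ t Vec.∷ Vec.[]) i o

HaltsWithin : VConfig 6 → ℕ → List ℤ → Set
HaltsWithin s B res = ∃ λ t → t ≤ B × RunsV selector s t res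

via : ∀ {s s' c B res} → ReachesV selector s c s' → HaltsWithin s' B res → HaltsWithin s (c + B) res
via r (t , t≤B , h) = _ , +-monoʳ-≤ _ t≤B , reaches-runs r h

relax : ∀ {s B B' res} → B ≤ B' → HaltsWithin s B res → HaltsWithin s B' res
relax B≤B' (t , t≤B , h) = t , ≤-trans t≤B B≤B' , h

taken : ∀ {β l vs i o} → β ≡ true →
  just (vcfg (if β then suc l else suc (suc l)) vs i o) ≡ just (vcfg {6} (suc l) vs i o)
taken refl = refl

skipped : ∀ {β l vs i o} → β ≡ false →
  just (vcfg (if β then suc l else suc (suc l)) vs i o) ≡ just (vcfg {6} (suc (suc l)) vs i o)
skipped refl = refl

zyt-≡ : ∀ {l k v p z y t z' y' t' i o B res} → z ≡ z' → y ≡ y' → t ≡ t' →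
  HaltsWithin (state l k v p z' y' t' i o) B res → HaltsWithin (state l k v p z y t i o) B res
zyt-≡ refl refl refl h = h

bitLength-loop : ∀ {K i o B res} q a b c d j → 1 ≪ j ≤ q → q < 1 ≪ suc (d + j) →
  (∀ L → 1 ≪ L ≤ q → q < 1 ≪ suc L →
     HaltsWithin (state 17 K (+ q) (+ (1 ≪ suc L)) (+ (a ≪ L)) (+ (b ≪ L)) (+ (c ≪ L)) i o) B res) →
  HaltsWithin (state 10 K (+ q) (+ (1 ≪ j)) (+ (a ≪ j)) (+ (b ≪ j)) (+ (c ≪ j)) i o) (6 * d + 3 + B) res
bitLength-loop q a b c d j lo hi exit with q <? 1 ≪ suc j
... | yes q<2ʲ⁺¹ =
  relax (+-monoˡ-≤ _ (m≤n+m 3 (6 * d)))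
    (via (refl ▹ taken (lt-true q<2ʲ⁺¹) ▹ refl ▹ done) (exit j lo q<2ʲ⁺¹))
bitLength-loop q a b c zero j lo hi exit | no q≮2ʲ⁺¹ = contradiction hi q≮2ʲ⁺¹
bitLength-loop {B = B} q a b c (suc d) j lo hi exit | no q≮2ʲ⁺¹ =
  relax (≤-reflexive (solve 2 (λ d B → con 6 :+ (con 6 :* d :+ con 3 :+ B) := con 6 :* (con 1 :+ d) :+ con 3 :+ B) refl d B))
    (via (refl ▹ skipped (lt-false (≮⇒≥ q≮2ʲ⁺¹)) ▹ refl ▹ refl ▹ refl ▹ refl ▹ done)
      (bitLength-loop q a b c d (suc j) (≮⇒≥ q≮2ʲ⁺¹) (subst (λ x → q < 1 ≪ suc x) (sym (+-suc d j)) hi) exit))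

-- bz is the concatenation of the binary expansions of the entries of qs, and
-- by marks the leading digit of each expansion with a 1.
data Encoding : ∀ {n} → Vec ℕ n → List Bool → List Bool → Set where
  []    : Encoding Vec.[] [] []
  block : ∀ {n q L zs bz by} {qs : Vec ℕ n} → 1 ≪ L ≤ q → length zs ≡ suc L → fromBits zs ≡ q →
          Encoding qs bz by → Encoding (q Vec.∷ qs) (zs ++ bz) ((true ∷ replicate L false) ++ by)

Z-after-block : ∀ (zb zs : List Bool) L → length zs ≡ suc L →
  ((fromBits zb + fromBits zb) ≪ L) + fromBits zs ≡ fromBits (zb ++ zs)
Z-after-block zb zs L |zs|
  rewrite fromBits-++ zb zs | |zs| | ≪-≪ (fromBits zb) 1 L | +-comm L 1 = refl

Y-after-block : ∀ (yb : List Bool) L →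
  (fromBits yb + fromBits yb + 1) ≪ L ≡ fromBits (yb ++ (true ∷ replicate L false))
Y-after-block yb L
  rewrite fromBits-++ yb (true ∷ replicate L false) | ≪-distribʳ-+ (fromBits yb + fromBits yb) 1 L
        | ≪-≪ (fromBits yb) 1 L | length-replicate L {false} | fromBits-replicate-false L
        | +-comm L 1 | +-identityʳ (1 ≪ L) = refl

T-after-block : ∀ (zb zs : List Bool) L → length zs ≡ suc L →
  ((1 ≪ length zb) + (1 ≪ length zb)) ≪ L ≡ 1 ≪ length (zb ++ zs)
T-after-block zb zs L |zs| rewrite length-++ zb {zs} | |zs| =
  trans (≪-≪ 1 (suc (length zb)) L)
    (cong (1 ≪_) (trans (+-suc L (length zb)) (trans (cong suc (+-comm L (length zb))) (sym (+-suc (length zb) L)))))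

encode-loop : ∀ {n} (rest : Vec ℕ n) R zb yb v p k {B res} → All (Fits R) rest →
  (∀ bz by v' p' → Encoding rest bz by →
     HaltsWithin (state 20 (+ 0) v' p' (+ fromBits (zb ++ bz)) (+ fromBits (yb ++ by))
                         (+ (1 ≪ length (zb ++ bz))) [ k ] []) B res) →
  HaltsWithin (state 2 (+ n) v p (+ fromBits zb) (+ fromBits yb) (+ (1 ≪ length zb))
                     (List.map +_ (toList rest) ++ [ k ]) [])
              (n * (13 + 6 * R) + 2 + B) res
encode-loop Vec.[] R zb yb v p k All.[] finish =
  via (refl ▹ refl ▹ done)
    (zyt-≡ (cong (λ x → + fromBits x) (sym (++-identityʳ zb))) (cong (λ x → + fromBits x) (sym (++-identityʳ yb)))
           (cong (λ x → + (1 ≪ length x)) (sym (++-identityʳ zb))) (finish [] [] v p []))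
encode-loop {suc n} (q Vec.∷ rest) R zb yb v p k {B} ((1≤q , q<2ᴿ⁺¹) All.∷ fits) finish =
  relax (≤-reflexive (solve 3 (λ n R B → con 7 :+ (con 6 :* R :+ con 3 :+ (con 3 :+ (n :* (con 13 :+ con 6 :* R) :+ con 2 :+ B)))
                                     := (con 1 :+ n) :* (con 13 :+ con 6 :* R) :+ con 2 :+ B) refl n R B))
    (via (refl ▹ refl ▹ refl ▹ refl ▹ refl ▹ refl ▹ refl ▹ done)
      (bitLength-loop q (fromBits zb + fromBits zb) (fromBits yb + fromBits yb + 1) ((1 ≪ length zb) + (1 ≪ length zb))
                      R 0 1≤q (subst (λ x → q < 1 ≪ suc x) (sym (+-identityʳ R)) q<2ᴿ⁺¹) append))
  where
  append : ∀ L → 1 ≪ L ≤ q → q < 1 ≪ suc L →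
    HaltsWithin (state 17 (+ suc n) (+ q) (+ (1 ≪ suc L)) (+ ((fromBits zb + fromBits zb) ≪ L))
                       (+ ((fromBits yb + fromBits yb + 1) ≪ L)) (+ (((1 ≪ length zb) + (1 ≪ length zb)) ≪ L))
                       (List.map +_ (toList rest) ++ [ k ]) [])
                (3 + (n * (13 + 6 * R) + 2 + B)) _
  append L 2ᴸ≤q q<2ᴸ⁺¹ with fixedWidthBits (suc L) q q<2ᴸ⁺¹
  ... | zs , |zs| , zs≡q =
    via (refl ▹ refl ▹ refl ▹ done)
      (zyt-≡ (cong +_ (trans (cong (λ x → _ + x) (sym zs≡q)) (Z-after-block zb zs L |zs|)))
             (cong +_ (Y-after-block yb L)) (cong +_ (T-after-block zb zs L |zs|))
        (encode-loop rest R (zb ++ zs) (yb ++ (true ∷ replicate L false)) (+ q) (+ (1 ≪ suc L)) k fits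
          (λ bz by v' p' enc →
            zyt-≡ (cong (λ x → + fromBits x) (++-assoc zb zs bz))
                  (cong (λ x → + fromBits x) (++-assoc yb (true ∷ replicate L false) by))
                  (cong (λ x → + (1 ≪ length x)) (++-assoc zb zs bz))
              (finish (zs ++ bz) ((true ∷ replicate L false) ++ by) v' p' (block 2ᴸ≤q |zs| zs≡q enc)))))

take-bit-Z : ∀ {K v p y j B res} z (zr : List Bool) →
  HaltsWithin (state 33 K v (+ bit z) (+ (fromBits zr ≪ suc j)) (+ (y + y)) (+ (1 ≪ (j + suc (length zr)))) [] []) B res →
  HaltsWithin (state 26 K v p (+ (fromBits (z ∷ zr) ≪ j)) (+ y) (+ (1 ≪ (j + suc (length zr)))) [] []) (6 + B) res
take-bit-Z {j = j} false zr h =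
  relax (+-monoˡ-≤ _ (n≤1+n 5))
    (via (refl ▹ refl ▹ refl ▹ taken (lt-true (fromBits-≪< zr j)) ▹ refl ▹ done) h)
take-bit-Z {j = j} true zr h =
  via (refl ▹ refl ▹ refl ▹ skipped (lt-false T≤Z) ▹ refl ▹ refl ▹ done)
    (zyt-≡ Z-T≡rest refl refl h)
  where
  T rest : ℕ
  T = 1 ≪ (j + suc (length zr))
  rest = fromBits zr ≪ suc j
  split : fromBits (true ∷ zr) ≪ suc j ≡ T + rest
  split = fromBits-true∷-≪ zr j
  T≤Z : T ≤ fromBits (true ∷ zr) ≪ suc j
  T≤Z = subst (T ≤_) (sym split) (m≤m+n T rest)
  Z-T≡rest : + (fromBits (true ∷ zr) ≪ suc j) ℤ.- + T ≡ + rest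
  Z-T≡rest = trans (cong (λ x → + x ℤ.- + T) split) (+[m+n]-+m≡+n T rest)

take-bit-Y : ∀ {v p z j l B res} (K : ℤ) y (yr : List Bool) → length yr ≡ l →
  HaltsWithin (state 37 (if y then K ℤ.- + 1 else K) v p z (+ (fromBits yr ≪ suc j)) (+ (1 ≪ (j + suc l))) [] []) B res →
  HaltsWithin (state 33 K v p z (+ (fromBits (y ∷ yr) ≪ suc j)) (+ (1 ≪ (j + suc l))) [] []) (3 + B) res
take-bit-Y {j = j} K false yr refl h =
  relax (+-monoˡ-≤ _ (n≤1+n 2)) (via (taken (lt-true (fromBits-≪< yr j)) ▹ refl ▹ done) h)
take-bit-Y {j = j} K true yr refl h =
  via (skipped (lt-false T≤Y) ▹ refl ▹ refl ▹ done) (zyt-≡ refl Y-T≡rest refl h)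
  where
  T rest : ℕ
  T = 1 ≪ (j + suc (length yr))
  rest = fromBits yr ≪ suc j
  split : fromBits (true ∷ yr) ≪ suc j ≡ T + rest
  split = fromBits-true∷-≪ yr j
  T≤Y : T ≤ fromBits (true ∷ yr) ≪ suc j
  T≤Y = subst (T ≤_) (sym split) (m≤m+n T rest)
  Y-T≡rest : + (fromBits (true ∷ yr) ≪ suc j) ℤ.- + T ≡ + rest
  Y-T≡rest = trans (cong (λ x → + x ℤ.- + T) split) (+[m+n]-+m≡+n T rest)

continue-skipping : ∀ {n v p z y t B res} →
  HaltsWithin (state 26 (+ suc n) v p z y t [] []) B res → HaltsWithin (state 37 (+ suc n) v p z y t [] []) (5 + B) res
continue-skipping h = relax (+-monoˡ-≤ _ (n≤1+n 4)) (via (refl ▹ refl ▹ refl ▹ refl ▹ done) h)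

continue-collecting : ∀ {v b z y t B res} →
  HaltsWithin (state 26 (+ 0) (+ (v + v + b)) (+ b) z y t [] []) B res →
  HaltsWithin (state 37 (+ 0) (+ v) (+ b) z y t [] []) (5 + B) res
continue-collecting h = via (refl ▹ refl ▹ refl ▹ refl ▹ refl ▹ done) h

output : ∀ {v p z y t} → HaltsWithin (state 37 -[1+ 0 ] (+ v) p z y t [] []) 5 [ + v ]
output = 4 , n≤1+n 4 , vgo refl (vgo refl (vgo refl (vgo refl (vstop refl))))

-- The decoding loop at line 26, when zr and yr are the digits of Z and Y not
-- yet consumed and j digits have been consumed.
decoding : ℤ → ℕ → ℤ → List Bool → List Bool → ℕ → VConfig 6
decoding k v p zr yr j =
  state 26 k (+ v) p (+ (fromBits zr ≪ j)) (+ (fromBits yr ≪ j)) (+ (1 ≪ (j + length zr))) [] []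

shift-T : ∀ {k v p z y j l B res} →
  HaltsWithin (state 26 k v p z y (+ (1 ≪ (suc j + l))) [] []) B res →
  HaltsWithin (state 26 k v p z y (+ (1 ≪ (j + suc l))) [] []) B res
shift-T {j = j} {l} = zyt-≡ refl refl (cong (λ x → + (1 ≪ x)) (+-suc j l))

skip-digit : ∀ {n v p B res} z (zr yr : List Bool) j → length yr ≡ length zr →
  HaltsWithin (decoding (+ suc n) v (+ bit z) zr yr (suc j)) B res →
  HaltsWithin (decoding (+ suc n) v p (z ∷ zr) (false ∷ yr) j) (14 + B) res
skip-digit {n} z zr yr j |yr| h =
  take-bit-Z {j = j} z zr (take-bit-Y {j = j} (+ suc n) false yr |yr| (continue-skipping (shift-T {j = j} h)))

collect-digit : ∀ {v p B res} z (zr yr : List Bool) j → length yr ≡ length zr →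
  HaltsWithin (decoding (+ 0) (v + v + bit z) (+ bit z) zr yr (suc j)) B res →
  HaltsWithin (decoding (+ 0) v p (z ∷ zr) (false ∷ yr) j) (14 + B) res
collect-digit z zr yr j |yr| h =
  take-bit-Z {j = j} z zr (take-bit-Y {j = j} (+ 0) false yr |yr| (continue-collecting (shift-T {j = j} h)))

pass-mark : ∀ {n v p B res} z (zr yr : List Bool) j → length yr ≡ length zr →
  HaltsWithin (decoding (+ suc n) v (+ bit z) zr yr (suc j)) B res →
  HaltsWithin (decoding (+ suc (suc n)) v p (z ∷ zr) (true ∷ yr) j) (14 + B) res
pass-mark {n} z zr yr j |yr| h =
  take-bit-Z {j = j} z zr (take-bit-Y {j = j} (+ suc (suc n)) true yr |yr| (continue-skipping (shift-T {j = j} h)))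

enter-block : ∀ {v p B res} z (zr yr : List Bool) j → length yr ≡ length zr →
  HaltsWithin (decoding (+ 0) (v + v + bit z) (+ bit z) zr yr (suc j)) B res →
  HaltsWithin (decoding (+ 1) v p (z ∷ zr) (true ∷ yr) j) (14 + B) res
enter-block z zr yr j |yr| h =
  take-bit-Z {j = j} z zr (take-bit-Y {j = j} (+ 1) true yr |yr| (continue-collecting (shift-T {j = j} h)))

leave-block : ∀ {v p} z (zr yr : List Bool) j → length yr ≡ length zr →
  HaltsWithin (decoding (+ 0) v p (z ∷ zr) (true ∷ yr) j) 14 [ + v ]
leave-block z zr yr j |yr| = take-bit-Z {j = j} z zr (take-bit-Y {j = j} (+ 0) true yr |yr| output)

length-unmarked : ∀ (zs zr yr : List Bool) → length yr ≡ length zr →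
  length (replicate (length zs) false ++ yr) ≡ length (zs ++ zr)
length-unmarked zs zr yr |yr|
  rewrite length-++ (replicate (length zs) false) {yr} | length-++ zs {zr}
        | length-replicate (length zs) {false} | |yr| = refl

digit-cost : ∀ n B → 14 + (14 * n + B) ≡ 14 * suc n + B
digit-cost n B = solve 2 (λ n B → con 14 :+ (con 14 :* n :+ B) := con 14 :* (con 1 :+ n) :+ B) refl n B

skip-digits : ∀ {n v B res} (zs zr yr : List Bool) j p → length yr ≡ length zr →
  (∀ p' → HaltsWithin (decoding (+ suc n) v p' zr yr (length zs + j)) B res) →
  HaltsWithin (decoding (+ suc n) v p (zs ++ zr) (replicate (length zs) false ++ yr) j) (14 * length zs + B) res
skip-digits [] zr yr j p |yr| rest = rest p
skip-digits {n} {v} {B} {res} (z ∷ zs) zr yr j p |yr| rest =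
  relax (≤-reflexive (digit-cost (length zs) B))
    (skip-digit z (zs ++ zr) (replicate (length zs) false ++ yr) j (length-unmarked zs zr yr |yr|)
      (skip-digits zs zr yr (suc j) (+ bit z) |yr|
        (λ p' → subst (λ x → HaltsWithin (decoding (+ suc n) v p' zr yr x) B res) (sym (+-suc (length zs) j)) (rest p'))))

collect-digits : ∀ {v B res} (zs zr yr : List Bool) j p → length yr ≡ length zr →
  (∀ p' → HaltsWithin (decoding (+ 0) (horner v zs) p' zr yr (length zs + j)) B res) →
  HaltsWithin (decoding (+ 0) v p (zs ++ zr) (replicate (length zs) false ++ yr) j) (14 * length zs + B) res
collect-digits [] zr yr j p |yr| rest = rest p
collect-digits {v} {B} {res} (z ∷ zs) zr yr j p |yr| rest =
  relax (≤-reflexive (digit-cost (length zs) B))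
    (collect-digit z (zs ++ zr) (replicate (length zs) false ++ yr) j (length-unmarked zs zr yr |yr|)
      (collect-digits zs zr yr (suc j) (+ bit z) |yr|
        (λ p' → subst (λ x → HaltsWithin (decoding (+ 0) (horner (v + v + bit z) zs) p' zr yr x) B res)
                      (sym (+-suc (length zs) j)) (rest p'))))

encoding-lengths : ∀ {n} {qs : Vec ℕ n} {bz by} → Encoding qs bz by → length by ≡ length bz
encoding-lengths [] = refl
encoding-lengths (block {L = L} {zs = zs} {bz = bz} {by = by} _ |zs| _ enc)
  rewrite length-++ (replicate L false) {by} | length-++ zs {bz} | length-replicate L {false}
        | |zs| | encoding-lengths enc = refl

-- The digits after a block start with a mark: the next block's, or the one
-- appended at line 22.
StartsWithMark : List Bool → List Bool → Set
StartsWithMark rz ry = ∃ λ z → ∃ λ zr → ∃ λ yr → rz ≡ z ∷ zr × ry ≡ true ∷ yr × length yr ≡ length zr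

starts-with-mark : ∀ {n} {qs : Vec ℕ n} {bz by} → Encoding qs bz by → StartsWithMark (bz ++ [ false ]) (by ++ [ true ])
starts-with-mark [] = false , [] , [] , refl , refl , refl
starts-with-mark (block {zs = []} _ () _ _)
starts-with-mark (block {L = L} {zs = z ∷ zs} {bz = bz} {by = by} _ |zs| _ enc) =
  z , (zs ++ bz) ++ [ false ] , (replicate L false ++ by) ++ [ true ] , refl , refl , lengths
  where
  lengths : length ((replicate L false ++ by) ++ [ true ]) ≡ length ((zs ++ bz) ++ [ false ])
  lengths rewrite length-++ (replicate L false ++ by) {[ true ]} | length-++ (replicate L false) {by}
                | length-++ (zs ++ bz) {[ false ]} | length-++ zs {bz} | length-replicate L {false}
                | suc-injective |zs| | encoding-lengths enc = refl

decode-here : ∀ {p} z zs (rz ry : List Bool) j → length ry ≡ length rz → StartsWithMark rz ry →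
  HaltsWithin (decoding (+ 1) 0 p (z ∷ zs ++ rz) (true ∷ replicate (length zs) false ++ ry) j)
              (14 + (14 * length zs + 14)) [ + fromBits (z ∷ zs) ]
decode-here z zs rz ry j |ry| (z' , zr' , yr' , refl , refl , |yr'|) =
  enter-block z (zs ++ rz) (replicate (length zs) false ++ ry) j (length-unmarked zs rz ry |ry|)
    (collect-digits zs rz ry (suc j) (+ bit z) |ry|
      (λ p' → subst (λ v → HaltsWithin (decoding (+ 0) (horner (bit z) zs) p' rz ry (length zs + suc j)) 14 [ + v ])
                    (horner-bit z zs) (leave-block z' zr' yr' (length zs + suc j) |yr'|)))

decode-later : ∀ {n p B res} z zs (rz ry : List Bool) j → length ry ≡ length rz →
  (∀ p' → HaltsWithin (decoding (+ suc n) 0 p' rz ry (length zs + suc j)) B res) →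
  HaltsWithin (decoding (+ suc (suc n)) 0 p (z ∷ zs ++ rz) (true ∷ replicate (length zs) false ++ ry) j)
              (14 + (14 * length zs + B)) res
decode-later z zs rz ry j |ry| rest =
  pass-mark z (zs ++ rz) (replicate (length zs) false ++ ry) j (length-unmarked zs rz ry |ry|)
    (skip-digits zs rz ry (suc j) (+ bit z) |ry| rest)

decode : ∀ {n} (qs : Vec ℕ n) (k : Fin n) {bz by} p j → Encoding qs bz by →
  HaltsWithin (decoding (+ suc (toℕ k)) 0 p (bz ++ [ false ]) (by ++ [ true ]) j)
              (14 * length (bz ++ [ false ])) [ + lookup qs k ]
decode (q Vec.∷ qs) k p j (block {zs = []} _ () _ _)
decode (q Vec.∷ qs) k p j (block {L = L} {zs = z ∷ zs} {bz} {by} _ |z∷zs| zs≡q enc)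
  rewrite ++-assoc zs bz [ false ] | ++-assoc (replicate L false) by [ true ] | sym (suc-injective |z∷zs|)
  = decode-block k
  where
  rz ry : List Bool
  rz = bz ++ [ false ]
  ry = by ++ [ true ]
  |ry| : length ry ≡ length rz
  |ry| = trans (length-++ by) (trans (cong (_+ 1) (encoding-lengths enc)) (sym (length-++ bz)))
  block-cost : 14 * length (z ∷ zs ++ rz) ≡ 14 + (14 * length zs + 14 * length rz)
  block-cost rewrite length-++ zs {rz} =
    solve 2 (λ a c → con 14 :* (con 1 :+ (a :+ c)) := con 14 :+ (con 14 :* a :+ con 14 :* c)) refl (length zs) (length rz)
  1≤|rz| : 1 ≤ length rz
  1≤|rz| = subst (1 ≤_) (sym (length-++ bz)) (m≤n+m 1 (length bz))
  decode-block : (k : Fin _) →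
    HaltsWithin (decoding (+ suc (toℕ k)) 0 p (z ∷ zs ++ rz) (true ∷ replicate (length zs) false ++ ry) j)
                (14 * length (z ∷ zs ++ rz)) [ + lookup (q Vec.∷ qs) k ]
  decode-block Fin.zero =
    relax (≤-trans (+-monoʳ-≤ 14 (+-monoʳ-≤ (14 * length zs) (*-monoʳ-≤ 14 1≤|rz|))) (≤-reflexive (sym block-cost)))
      (subst (λ v → HaltsWithin (decoding (+ 1) 0 p (z ∷ zs ++ rz) (true ∷ replicate (length zs) false ++ ry) j)
                                (14 + (14 * length zs + 14)) [ + v ])
             zs≡q (decode-here z zs rz ry j |ry| (starts-with-mark enc)))
  decode-block (Fin.suc k') =
    relax (≤-reflexive (sym block-cost))
      (decode-later z zs rz ry j |ry| (λ p' → decode qs k' p' (length zs + suc j) enc))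

encoding-length≤ : ∀ {n} {qs : Vec ℕ n} {bz by} R → Encoding qs bz by → All (Fits R) qs → length bz ≤ n * suc R
encoding-length≤ R [] All.[] = z≤n
encoding-length≤ R (block {zs = zs} {bz = bz} 2ᴸ≤q |zs| _ enc) ((_ , q<2ᴿ⁺¹) All.∷ fits)
  rewrite length-++ zs {bz} | |zs| =
  +-mono-≤ (1≪m<1≪n⇒m<n (≤-<-trans 2ᴸ≤q q<2ᴿ⁺¹)) (encoding-length≤ R enc fits)

selector-time : ℕ → ℕ → ℕ
selector-time m R = 2 + (m * (13 + 6 * R) + 2 + (6 + 14 * (m * suc R + 1)))

selector-time≤ : ∀ m R → 1 ≤ m → 1 ≤ R → selector-time m R ≤ 71 * (m * R)
selector-time≤ m R 1≤m 1≤R = begin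
  selector-time m R
    ≡⟨ solve 2 (λ m R → con 2 :+ (m :* (con 13 :+ con 6 :* R) :+ con 2 :+ (con 6 :+ con 14 :* (m :* (con 1 :+ R) :+ con 1)))
                     := con 24 :+ con 27 :* m :+ con 20 :* (m :* R)) refl m R ⟩
  24 + 27 * m + 20 * (m * R)
    ≤⟨ +-mono-≤ (+-mono-≤ (*-monoʳ-≤ 24 1≤mR) (*-monoʳ-≤ 27 m≤mR)) ≤-refl ⟩
  24 * (m * R) + 27 * (m * R) + 20 * (m * R)
    ≡⟨ solve 1 (λ x → con 24 :* x :+ con 27 :* x :+ con 20 :* x := con 71 :* x) refl (m * R) ⟩
  71 * (m * R) ∎
  where
  open ≤-Reasoning
  1≤mR : 1 ≤ m * R
  1≤mR = *-mono-≤ 1≤m 1≤R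
  m≤mR : m ≤ m * R
  m≤mR = subst (_≤ m * R) (*-identityʳ m) (*-monoʳ-≤ m 1≤R)

selector-runs : ∀ m (qs : Vec ℕ m) (k : Fin m) → All (1 ≤_) qs →
  HaltsWithin (vcfg 0 (Vec.replicate 6 (+ 0)) (taskInput m qs k) []) (selector-time m (rOf qs)) [ + lookup qs k ]
selector-runs m qs k positive =
  via (refl ▹ refl ▹ done) (encode-loop qs R [] [] (+ 0) (+ 0) (+ suc (toℕ k)) (inputs-fit qs positive) decode-all)
  where
  R : ℕ
  R = rOf qs
  decode-all : ∀ bz by v p → Encoding qs bz by →
    HaltsWithin (state 20 (+ 0) v p (+ fromBits bz) (+ fromBits by) (+ (1 ≪ length bz)) [ + suc (toℕ k) ] [])
                (6 + 14 * (m * suc R + 1)) [ + lookup qs k ]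
  decode-all bz by v p enc =
    relax (+-monoʳ-≤ 6 (*-monoʳ-≤ 14 (subst (_≤ m * suc R + 1) (sym (length-++ bz))
                                             (+-monoˡ-≤ 1 (encoding-length≤ R enc (inputs-fit qs positive))))))
      (via (refl ▹ refl ▹ refl ▹ refl ▹ refl ▹ refl ▹ done)
        (zyt-≡ (cong +_ (sym (trans (fromBits-++ bz [ false ]) (+-identityʳ _))))
               (cong +_ (sym (fromBits-++ by [ true ])))
               (cong (λ x → + (1 ≪ x)) (sym (trans (length-++ bz) (+-comm _ 1))))
          (decode qs k p 0 enc)))

selector-halts : ∀ m (qs : Vec ℕ m) (k : Fin m) → All (1 ≤_) qs →
  ∃ λ t → t ≤ selector-time m (rOf qs) × HaltsWith selector (taskInput m qs k) t [ + lookup qs k ]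
selector-halts m qs k positive with selector-runs m qs k positive
... | t , t≤ , runs =
  t , t≤ , runsV⇒runs selector 0 (λ _ → + 0) (Vec.replicate 6 (+ 0)) (taskInput m qs k) []
                      (λ i → sym (lookup-replicate i (+ 0))) runs

selector-solves : Solves selector
selector-solves m qs k (_ , positive) with selector-halts m qs k positive
... | t , _ , halts = t , halts

selector-littleOhB : LittleOhB selector
selector-littleOhB a b = c' , bounded
  where
  c' : ℕ
  c' = 2 ^ (71 * suc b)
  bounded : ∀ m (qs : Vec ℕ m) (k : Fin m) → Valid m qs → c' ≤ m × c' ≤ rOf qs →
    ∀ t o → HaltsWith selector (taskInput m qs k) t o → suc b * t ≤ suc a * f m (rOf qs)
  bounded m qs k (1≤m , positive) (c'≤m , c'≤r) t o halts with selector-halts m qs k positive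
  ... | t₀ , t₀≤ , halts₀ rewrite runs-time-unique halts halts₀ = begin
    suc b * t₀
      ≤⟨ *-monoʳ-≤ (suc b) (≤-trans t₀≤ (selector-time≤ m r 1≤m 1≤r)) ⟩
    suc b * (71 * (m * r))
      ≡⟨ solve 3 (λ b m r → b :* (con 71 :* (m :* r)) := (con 71 :* b) :* (m :* r)) refl (suc b) m r ⟩
    (71 * suc b) * (m * r)
      ≤⟨ *-monoˡ-≤ (m * r) (2^n≤m⇒n≤⌊log₂m⌋ (71 * suc b) m c'≤m) ⟩
    ⌊log₂ m ⌋ * (m * r)
      ≡⟨ solve 3 (λ l m r → l :* (m :* r) := r :* m :* l) refl ⌊log₂ m ⌋ m r ⟩
    f m r
      ≤⟨ m≤n*m (f m r) (suc a) ⟩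
    suc a * f m r ∎
    where
    open ≤-Reasoning
    r : ℕ
    r = rOf qs
    1≤r : 1 ≤ r
    1≤r = ≤-trans (m^n>0 2 (71 * suc b)) c'≤r

writing-takes-time : ∀ {n} {P : Program n} {inp t x xs} → HaltsWith P inp t (x ∷ xs) → 1 ≤ t
writing-takes-time (go _ _) = s≤s z≤n

f[1,r]≡0 : ∀ r → f 1 r ≡ 0
f[1,r]≡0 r = *-zeroʳ (r * 1)

no-solver-is-littleOhA : ∀ {n} (P : Program n) → Solves P → ¬ LittleOhA P
no-solver-is-littleOhA P solves littleOh = <⇒≱ (writing-takes-time halts) t≤0
  where
  c' : ℕ
  c' = proj₁ (littleOh 0 0)
  qs : Vec ℕ 1
  qs = 2 ^ c' Vec.∷ Vec.[]
  valid : Valid 1 qs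
  valid = s≤s z≤n , m^n>0 2 c' All.∷ All.[]
  c'≤r : c' ≤ rOf qs
  c'≤r = 2^n≤m⇒n≤⌊log₂m⌋ c' (2 ^ c' ⊔ 2) (m≤m⊔n (2 ^ c') 2)
  t : ℕ
  t = proj₁ (solves 1 qs Fin.zero valid)
  halts : HaltsWith P (taskInput 1 qs Fin.zero) t [ + 2 ^ c' ]
  halts = proj₂ (solves 1 qs Fin.zero valid)
  t≤0 : t ≤ 0
  t≤0 = subst₂ _≤_ (*-identityˡ t) (trans (*-identityˡ _) (f[1,r]≡0 (rOf qs)))
                   (proj₂ (littleOh 0 0) 1 qs Fin.zero valid (inj₂ c'≤r) t _ halts)

theorem8 : ((n : ℕ) (P : Program n) → ¬ (Solves P × LittleOhA P))
    × Σ ℕ (λ n → Σ (Program n) (λ P → Solves P × LittleOhB P))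
theorem8 = (λ n P (solves , littleOh) → no-solver-is-littleOhA P solves littleOh)
         , (6 , selector , selector-solves , selector-littleOhB)
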